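{- Let $P\colon\mathcal{C}^{op}\to\mathbf{DLat}$ be a $\{\land,\lor\}$-doctrine and $P^\exists$ its existential completion as described in the context. For each object $c\in\mathcal{C}$, the poset $P^\exists(c)$ is a distributive lattice.
   Context: A $\{\land,\lor\}$-doctrine is a functor $P\colon\mathcal{C}^{op}\to\mathbf{DLat}$ from the opposite of a category $\mathcal{C}$ with finite products to distributive lattices and lattice homomorphisms; write $f^\ast=P(f)$. For objects $d,c$, $\pi_d\colon d\times c\to c$ is the projection forgetting $d$. For $c\in\mathcal{C}$, $P^\exists(c)$ is the posetal reflection of the preorder whose elements are finite sets $\{(d_1,x_1),\dots,(d_n,x_n)\}$ with $d_i\in\mathcal{C}$ and $x_i\in P(d_i\times c)$, ordered by: $\{(d_i,x_i)\}_{i\le n}\le\{(e_j,y_j)\}_{j\le m}$ iff for each $i\le n$ there are finitely many arrows $r_\ell\colon d_i\times c\to e_{j_\ell}\times c$ ($\ell=1,\dots,k$, $j_\ell\le m$) with $\pi_{e_{j_\ell}}\circ r_\ell=\pi_{d_i}$ for all $\ell$ and $x_i\le r_1^\ast y_{j_1}\lor\dots\lor r_k^\ast y_{j_k}$. -}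

module Defs where

open import Level using (Level; _⊔_; suc)
open import Data.Product using (Σ; Σ-syntax; _,_; proj₁; proj₂; _×_)
open import Data.List using (List; length; lookup)
open import Data.List.NonEmpty using (List⁺; foldr₁) renaming (map to map⁺)
open import Data.Fin using (Fin)
open import Relation.Binary.PropositionalEquality using (_≡_)
open import Algebra.Lattice.Bundles using (DistributiveLattice)
open import Algebra.Lattice.Morphism.Structures using (module LatticeMorphisms)
open import Relation.Binary.Lattice.Structures using (IsDistributiveLattice)

record CartesianCategory (o h : Level) : Set (suc (o ⊔ h)) where
  infixr 9 _∘_
  infixr 7 _⊗_
  field
    Obj  : Set o
    Hom  : Obj → Obj → Set h
    id   : ∀ {a} → Hom a a
    _∘_  : ∀ {a b c} → Hom b c → Hom a b → Hom a c
    identityˡ : ∀ {a b} (f : Hom a b) → id ∘ f ≡ f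
    identityʳ : ∀ {a b} (f : Hom a b) → f ∘ id ≡ f
    assoc     : ∀ {a b c d} (f : Hom c d) (g : Hom b c) (k : Hom a b) →
                (f ∘ g) ∘ k ≡ f ∘ (g ∘ k)
    ⊤    : Obj
    !    : ∀ {a} → Hom a ⊤
    !-unique : ∀ {a} (f : Hom a ⊤) → f ≡ !
    _⊗_  : Obj → Obj → Obj
    π₁   : ∀ {a b} → Hom (a ⊗ b) a
    π₂   : ∀ {a b} → Hom (a ⊗ b) b
    ⟨_,_⟩ : ∀ {x a b} → Hom x a → Hom x b → Hom x (a ⊗ b)
    π₁-β : ∀ {x a b} (f : Hom x a) (g : Hom x b) → π₁ ∘ ⟨ f , g ⟩ ≡ f
    π₂-β : ∀ {x a b} (f : Hom x a) (g : Hom x b) → π₂ ∘ ⟨ f , g ⟩ ≡ g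
    ⟨⟩-unique : ∀ {x a b} (f : Hom x a) (g : Hom x b) (u : Hom x (a ⊗ b)) →
                π₁ ∘ u ≡ f → π₂ ∘ u ≡ g → u ≡ ⟨ f , g ⟩

record Doctrine {o h : Level} (C : CartesianCategory o h) (a l : Level)
       : Set (suc (o ⊔ h ⊔ a ⊔ l)) where
  open CartesianCategory C
  field
    P     : Obj → DistributiveLattice a l
  open module P-at (x : Obj) = DistributiveLattice (P x)
    using () renaming (Carrier to ∣_∣)
  field
    reindex : ∀ {x y} → Hom x y → ∣ y ∣ → ∣ x ∣
    reindex-hom : ∀ {x y} (f : Hom x y) →
      LatticeMorphisms.IsLatticeHomomorphism
        (DistributiveLattice.rawLattice (P y))
        (DistributiveLattice.rawLattice (P x)) (reindex f)
    reindex-id : ∀ {x} (u : ∣ x ∣) →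
      DistributiveLattice._≈_ (P x) (reindex id u) u
    reindex-∘ : ∀ {x y z} (g : Hom y z) (f : Hom x y) (u : ∣ z ∣) →
      DistributiveLattice._≈_ (P x) (reindex (g ∘ f) u) (reindex f (reindex g u))

-- The existential completion P^∃ (as a preorder on representatives)

module Existential {o h a l : Level} {C : CartesianCategory o h}
                   (D : Doctrine C a l) where
  open CartesianCategory C
  open Doctrine D

  ∣_∣ : Obj → Set a
  ∣ x ∣ = DistributiveLattice.Carrier (P x)

  _≤P_ : ∀ {x} → ∣ x ∣ → ∣ x ∣ → Set l
  _≤P_ {x} u v = DistributiveLattice._≈_ (P x) (DistributiveLattice._∧_ (P x) u v) u

  ⋁⁺ : ∀ {x} → List⁺ ∣ x ∣ → ∣ x ∣
  ⋁⁺ {x} = foldr₁ (DistributiveLattice._∨_ (P x))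

  Pair : Obj → Set (o ⊔ a)
  Pair c = Σ[ d ∈ Obj ] ∣ d ⊗ c ∣

  -- representatives of elements of P^∃(c): finite (listed) families of pairs
  Rep : Obj → Set (o ⊔ a)
  Rep c = List (Pair c)

  Over : ∀ {c} (d : Obj) (B : Rep c) → Set h
  Over {c} d B = Σ[ j ∈ Fin (length B) ]
                 Σ[ r ∈ Hom (d ⊗ c) (proj₁ (lookup B j) ⊗ c) ] (π₂ ∘ r ≡ π₂)

  pull : ∀ {c d} (B : Rep c) → Over d B → ∣ d ⊗ c ∣
  pull B (j , r , _) = reindex r (proj₂ (lookup B j))

  _≤∃_ : ∀ {c} → Rep c → Rep c → Set (h ⊔ l)
  _≤∃_ {c} A B = (i : Fin (length A)) →
    Σ[ rs ∈ List⁺ (Over (proj₁ (lookup A i)) B) ]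
      (proj₂ (lookup A i) ≤P ⋁⁺ (map⁺ (pull B) rs))

  _≈∃_ : ∀ {c} → Rep c → Rep c → Set (h ⊔ l)
  A ≈∃ B = (A ≤∃ B) × (B ≤∃ A)

  IsDistributiveLattice∃ : Obj → Set (o ⊔ h ⊔ a ⊔ l)
  IsDistributiveLattice∃ c =
    Σ[ join ∈ (Rep c → Rep c → Rep c) ] Σ[ meet ∈ (Rep c → Rep c → Rep c) ]
      IsDistributiveLattice (_≈∃_ {c}) (_≤∃_ {c}) join meet

{-# OPTIONS --safe #-}
-- Write q ◁ B when the single pair q = (d , x) lies below the family B; the
-- order on families is pointwise in ◁. Three closure properties of ◁ carry the
-- whole argument: it is downward closed in P(d ⊗ c), closed under binary (hence
-- finite nonempty) joins by concatenating the covering lists, and stable under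
-- reindexing along arrows over c by composing the covering arrows. Transitivity
-- follows, and concatenation of families is their join. The meet of (d , x) and
-- (e , y) is x ∧ y pulled back to (d ⊗ e) ⊗ c, the product of d ⊗ c and e ⊗ c
-- over c, and the meet of two families lists all pairwise meets; a common lower
-- bound lies below it because ∧ distributes over finite joins in each fibre.
-- Distributivity then holds as an equation of lists.
module Submission where

open import Level using (Level; _⊔_)
open import Data.Product using (Σ-syntax; ∃₂; _,_; proj₁; proj₂; _×_)
open import Data.Sum using ([_,_]′)
open import Data.List using ([]; _∷_; _++_; lookup; cartesianProductWith)
open import Data.List.Properties using (cartesianProductWith-distribʳ-++)
open import Data.List.NonEmpty using (List⁺; _∷_; [_]; foldr₁; _⁺++⁺_) renaming (map to map⁺)
open import Data.List.NonEmpty.Properties using (map-∘)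
open import Data.List.Membership.Propositional using (_∈_)
open import Data.List.Membership.Propositional.Properties
  using (∈-lookup; ∈-++⁻; ∈-cartesianProductWith⁺; ∈-cartesianProductWith⁻)
open import Data.List.Relation.Unary.Any using (index)
open import Data.List.Relation.Unary.Any.Properties using (lookup-index)
open import Data.List.Relation.Binary.Subset.Propositional using (_⊆_)
open import Data.List.Relation.Binary.Subset.Propositional.Properties using (xs⊆xs++ys; xs⊆ys++xs)
open import Function using (flip)
open import Algebra.Lattice.Bundles using (DistributiveLattice)
open import Algebra.Lattice.Morphism.Structures using (module LatticeMorphisms)
open import Relation.Binary.Core using (Rel)
open import Relation.Binary.Bundles using (Poset; Preorder; Setoid)
open import Relation.Binary.Structures using (IsPartialOrder)
open import Relation.Binary.Lattice.Definitions using (Supremum; Infimum)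
open import Relation.Binary.PropositionalEquality as ≡ using (_≡_)
open import Defs

import Algebra.Lattice.Properties.Lattice as LatticeProperties
import Relation.Binary.Lattice.Bundles as OrderLattice
import Relation.Binary.Lattice.Properties.JoinSemilattice as JoinSemilatticeProperties
import Relation.Binary.Properties.Preorder as PreorderProperties
import Relation.Binary.Reasoning.PartialOrder as PosetReasoning

module MeetOrder {a l : Level} (L : DistributiveLattice a l) where
  open DistributiveLattice L

  infix 4 _≤_

  -- This is _≤P_ of Defs; the standard library's natural order states the
  -- equation the other way round (x ≈ x ∧ y), hence the uses of sym below.
  _≤_ : Rel Carrier l
  x ≤ y = x ∧ y ≈ x

  private
    module O = OrderLattice.Lattice (LatticeProperties.∨-∧-orderTheoreticLattice lattice)

  poset : Poset a l l
  poset = record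
    { _≤_            = _≤_
    ; isPartialOrder = record
      { isPreorder = record
        { isEquivalence = isEquivalence
        ; reflexive     = λ x≈y → sym (O.reflexive x≈y)
        ; trans         = λ x≤y y≤z → sym (O.trans (sym x≤y) (sym y≤z))
        }
      ; antisym = λ x≤y y≤x → O.antisym (sym x≤y) (sym y≤x)
      }
    }

  open Poset poset public using () renaming (reflexive to ≤-reflexive; trans to ≤-trans)

  x∧y≤x : ∀ x y → x ∧ y ≤ x
  x∧y≤x x y = sym (O.x∧y≤x x y)

  x∧y≤y : ∀ x y → x ∧ y ≤ y
  x∧y≤y x y = sym (O.x∧y≤y x y)

  ∧-greatest : ∀ {x y z} → x ≤ y → x ≤ z → x ≤ y ∧ z
  ∧-greatest x≤y x≤z = sym (O.∧-greatest (sym x≤y) (sym x≤z))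

  ∨-monotonic : ∀ {x y u v} → x ≤ y → u ≤ v → x ∨ u ≤ y ∨ v
  ∨-monotonic x≤y u≤v =
    sym (JoinSemilatticeProperties.∨-monotonic O.joinSemilattice (sym x≤y) (sym u≤v))

List⁺-induction : ∀ {ι p} {I : Set ι} (Pr : List⁺ I → Set p) →
                  (∀ i → Pr [ i ]) → (∀ i j js → Pr (j ∷ js) → Pr (i ∷ j ∷ js)) →
                  ∀ is → Pr is
List⁺-induction Pr base step (i ∷ is) = go i is
  where
  go : ∀ i is → Pr (i ∷ is)
  go i []       = base i
  go i (j ∷ js) = step i j js (go j js)

module NonEmptyJoins {a l : Level} (L : DistributiveLattice a l) where
  open DistributiveLattice L

  ⋁⁺ : List⁺ Carrier → Carrier
  ⋁⁺ = foldr₁ _∨_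

  module _ {ι : Level} {I : Set ι} where

    ⋁⁺-cong : ∀ {f g : I → Carrier} → (∀ i → f i ≈ g i) →
              ∀ is → ⋁⁺ (map⁺ f is) ≈ ⋁⁺ (map⁺ g is)
    ⋁⁺-cong {f} {g} f≈g = List⁺-induction (λ is → ⋁⁺ (map⁺ f is) ≈ ⋁⁺ (map⁺ g is))
      f≈g (λ i _ _ → ∨-cong (f≈g i))

    ⋁⁺-⁺++⁺ : ∀ (f : I → Carrier) is js →
              ⋁⁺ (map⁺ f (is ⁺++⁺ js)) ≈ ⋁⁺ (map⁺ f is) ∨ ⋁⁺ (map⁺ f js)
    ⋁⁺-⁺++⁺ f is js =
      List⁺-induction (λ is → ⋁⁺ (map⁺ f (is ⁺++⁺ js)) ≈ ⋁⁺ (map⁺ f is) ∨ ⋁⁺ (map⁺ f js))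
        (λ _ → refl) (λ _ _ _ ih → trans (∨-cong refl ih) (sym (∨-assoc _ _ _))) is

    ∧-distribˡ-⋁⁺ : ∀ x (f : I → Carrier) is →
                    x ∧ ⋁⁺ (map⁺ f is) ≈ ⋁⁺ (map⁺ (λ i → x ∧ f i) is)
    ∧-distribˡ-⋁⁺ x f =
      List⁺-induction (λ is → x ∧ ⋁⁺ (map⁺ f is) ≈ ⋁⁺ (map⁺ (λ i → x ∧ f i) is))
        (λ _ → refl) (λ _ _ _ ih → trans (∧-distribˡ-∨ x _ _) (∨-cong refl ih))

    ∧-distribʳ-⋁⁺ : ∀ x (f : I → Carrier) is →
                    ⋁⁺ (map⁺ f is) ∧ x ≈ ⋁⁺ (map⁺ (λ i → f i ∧ x) is)
    ∧-distribʳ-⋁⁺ x f is =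
      trans (∧-comm _ x) (trans (∧-distribˡ-⋁⁺ x f is) (⋁⁺-cong (λ i → ∧-comm x (f i)) is))

module LatticeHomomorphismProperties
  {a₁ l₁ a₂ l₂ : Level} {L : DistributiveLattice a₁ l₁} {M : DistributiveLattice a₂ l₂}
  {h : DistributiveLattice.Carrier L → DistributiveLattice.Carrier M}
  (isHom : LatticeMorphisms.IsLatticeHomomorphism
             (DistributiveLattice.rawLattice L) (DistributiveLattice.rawLattice M) h)
  where
  open LatticeMorphisms.IsLatticeHomomorphism isHom
  open DistributiveLattice M
  private
    module L = DistributiveLattice L
    module ≤L = MeetOrder L
    module ⋁L = NonEmptyJoins L
  open MeetOrder M
  open NonEmptyJoins M

  mono : ∀ {x y} → x ≤L.≤ y → h x ≤ h y
  mono {x} {y} x≤y = trans (sym (∧-homo x y)) (⟦⟧-cong x≤y)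

  ⋁⁺-homo : ∀ {ι} {I : Set ι} (f : I → L.Carrier) is →
            h (⋁L.⋁⁺ (map⁺ f is)) ≈ ⋁⁺ (map⁺ (λ i → h (f i)) is)
  ⋁⁺-homo f = List⁺-induction (λ is → h (⋁L.⋁⁺ (map⁺ f is)) ≈ ⋁⁺ (map⁺ (λ i → h (f i)) is))
    (λ _ → refl) (λ _ _ _ ih → trans (∨-homo _ _) (∨-cong refl ih))

-- For objects d, e the object (d ⊗ e) ⊗ c, with p₁ and p₂, is the product of
-- d ⊗ c and e ⊗ c in the slice over c; ⟪ r , s ⟫ is the induced pairing.
module SliceProducts {o h : Level} (C : CartesianCategory o h) (c : CartesianCategory.Obj C) where
  open CartesianCategory C
  open ≡.≡-Reasoning

  ⊗-ext : ∀ {x a b} {u v : Hom x (a ⊗ b)} → π₁ ∘ u ≡ π₁ ∘ v → π₂ ∘ u ≡ π₂ ∘ v → u ≡ v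
  ⊗-ext {u = u} {v} p q = ≡.trans (⟨⟩-unique _ _ u p q) (≡.sym (⟨⟩-unique _ _ v ≡.refl ≡.refl))

  ∘-over : ∀ {d e f} {s : Hom (e ⊗ c) (f ⊗ c)} {r : Hom (d ⊗ c) (e ⊗ c)} →
           π₂ ∘ s ≡ π₂ → π₂ ∘ r ≡ π₂ → π₂ ∘ (s ∘ r) ≡ π₂
  ∘-over {s = s} {r} s-over r-over = begin
    π₂ ∘ (s ∘ r)  ≡⟨ assoc π₂ s r ⟨
    (π₂ ∘ s) ∘ r  ≡⟨ ≡.cong (_∘ r) s-over ⟩
    π₂ ∘ r        ≡⟨ r-over ⟩
    π₂            ∎

  p₁ : ∀ {d e} → Hom ((d ⊗ e) ⊗ c) (d ⊗ c)
  p₁ = ⟨ π₁ ∘ π₁ , π₂ ⟩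

  p₂ : ∀ {d e} → Hom ((d ⊗ e) ⊗ c) (e ⊗ c)
  p₂ = ⟨ π₂ ∘ π₁ , π₂ ⟩

  ⟪_,_⟫ : ∀ {x d e} → Hom (x ⊗ c) (d ⊗ c) → Hom (x ⊗ c) (e ⊗ c) → Hom (x ⊗ c) ((d ⊗ e) ⊗ c)
  ⟪ r , s ⟫ = ⟨ ⟨ π₁ ∘ r , π₁ ∘ s ⟩ , π₂ ⟩

  over-ext : ∀ {d e} {u v : Hom (d ⊗ c) (e ⊗ c)} →
             π₂ ∘ u ≡ π₂ → π₂ ∘ v ≡ π₂ → π₁ ∘ u ≡ π₁ ∘ v → u ≡ v
  over-ext u-over v-over π₁-eq = ⊗-ext π₁-eq (≡.trans u-over (≡.sym v-over))

  p₁-β : ∀ {x d e} {r : Hom (x ⊗ c) (d ⊗ c)} {s : Hom (x ⊗ c) (e ⊗ c)} →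
         π₂ ∘ r ≡ π₂ → p₁ ∘ ⟪ r , s ⟫ ≡ r
  p₁-β {r = r} {s} r-over = over-ext (∘-over (π₂-β _ _) (π₂-β _ _)) r-over (begin
    π₁ ∘ (p₁ ∘ ⟪ r , s ⟫)     ≡⟨ assoc _ _ _ ⟨
    (π₁ ∘ p₁) ∘ ⟪ r , s ⟫     ≡⟨ ≡.cong (_∘ ⟪ r , s ⟫) (π₁-β _ _) ⟩
    (π₁ ∘ π₁) ∘ ⟪ r , s ⟫     ≡⟨ assoc _ _ _ ⟩
    π₁ ∘ (π₁ ∘ ⟪ r , s ⟫)     ≡⟨ ≡.cong (π₁ ∘_) (π₁-β _ _) ⟩
    π₁ ∘ ⟨ π₁ ∘ r , π₁ ∘ s ⟩  ≡⟨ π₁-β _ _ ⟩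
    π₁ ∘ r                    ∎)

  p₂-β : ∀ {x d e} {r : Hom (x ⊗ c) (d ⊗ c)} {s : Hom (x ⊗ c) (e ⊗ c)} →
         π₂ ∘ s ≡ π₂ → p₂ ∘ ⟪ r , s ⟫ ≡ s
  p₂-β {r = r} {s} s-over = over-ext (∘-over (π₂-β _ _) (π₂-β _ _)) s-over (begin
    π₁ ∘ (p₂ ∘ ⟪ r , s ⟫)     ≡⟨ assoc _ _ _ ⟨
    (π₁ ∘ p₂) ∘ ⟪ r , s ⟫     ≡⟨ ≡.cong (_∘ ⟪ r , s ⟫) (π₁-β _ _) ⟩
    (π₂ ∘ π₁) ∘ ⟪ r , s ⟫     ≡⟨ assoc _ _ _ ⟩
    π₂ ∘ (π₁ ∘ ⟪ r , s ⟫)     ≡⟨ ≡.cong (π₂ ∘_) (π₁-β _ _) ⟩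
    π₂ ∘ ⟨ π₁ ∘ r , π₁ ∘ s ⟩  ≡⟨ π₂-β _ _ ⟩
    π₁ ∘ s                    ∎)

module Completion {o h a l : Level} {C : CartesianCategory o h} (D : Doctrine C a l)
                  (c : CartesianCategory.Obj C) where
  open CartesianCategory C
  open Doctrine D
  open Existential D
  open SliceProducts C c

  private
    module Fibre (x : Obj) where
      open DistributiveLattice (P x) public
      open MeetOrder (P x) public
      open NonEmptyJoins (P x) public hiding (⋁⁺)
      open PosetReasoning poset public

    module Reindex {x y : Obj} (f : Hom x y) =
      LatticeHomomorphismProperties {L = P y} {M = P x} (reindex-hom f)

  infix 4 _◁_

  -- A ≤∃ B unfolds to (i : Fin (length A)) → lookup A i ◁ B.
  _◁_ : Pair c → Rep c → Set (h ⊔ l)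
  q ◁ B = Σ[ rs ∈ List⁺ (Over (proj₁ q) B) ] (proj₂ q ≤P ⋁⁺ (map⁺ (pull B) rs))

  ≤∃⇒◁ : ∀ {A B q} → A ≤∃ B → q ∈ A → q ◁ B
  ≤∃⇒◁ {B = B} A≤B q∈A = ≡.subst (_◁ B) (≡.sym (lookup-index q∈A)) (A≤B (index q∈A))

  ◁⇒≤∃ : ∀ {A B} → (∀ {q} → q ∈ A → q ◁ B) → A ≤∃ B
  ◁⇒≤∃ all◁ i = all◁ (∈-lookup i)

  ≤∃-refl : ∀ {A} → A ≤∃ A
  ≤∃-refl {A} i = [ i , id , identityʳ π₂ ] , ≤-reflexive (sym (reindex-id _))
    where open Fibre (proj₁ (lookup A i) ⊗ c)

  ∈⇒◁ : ∀ {q B} → q ∈ B → q ◁ B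
  ∈⇒◁ {B = B} = ≤∃⇒◁ {B} {B} (≤∃-refl {B})

  ⊆⇒≤∃ : ∀ {A B} → A ⊆ B → A ≤∃ B
  ⊆⇒≤∃ {A} {B} A⊆B = ◁⇒≤∃ {A} {B} (λ q∈A → ∈⇒◁ (A⊆B q∈A))

  ≤-◁-trans : ∀ {d x y E} → Fibre._≤_ (d ⊗ c) x y → (d , y) ◁ E → (d , x) ◁ E
  ≤-◁-trans {d} x≤y (rs , y≤) = rs , Fibre.≤-trans (d ⊗ c) x≤y y≤

  ◁-∨ : ∀ {d x y E} → (d , x) ◁ E → (d , y) ◁ E → (d , Fibre._∨_ (d ⊗ c) x y) ◁ E
  ◁-∨ {d} {E = E} (rs , x≤) (ss , y≤) = rs ⁺++⁺ ss ,
    ≤-trans (∨-monotonic x≤ y≤) (≤-reflexive (sym (⋁⁺-⁺++⁺ (pull E) rs ss)))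
    where open Fibre (d ⊗ c)

  ◁-⋁⁺ : ∀ {d E ι} {I : Set ι} (f : I → ∣ d ⊗ c ∣) is →
         (∀ i → (d , f i) ◁ E) → (d , ⋁⁺ (map⁺ f is)) ◁ E
  ◁-⋁⁺ {d} {E} f is all◁ =
    List⁺-induction (λ is → (d , ⋁⁺ (map⁺ f is)) ◁ E) all◁ (λ i _ _ → ◁-∨ {E = E} (all◁ i)) is

  ◁-reindex : ∀ {d e y E} (r : Hom (d ⊗ c) (e ⊗ c)) → π₂ ∘ r ≡ π₂ →
              (e , y) ◁ E → (d , reindex r y) ◁ E
  ◁-reindex {d} {e} {y} {E} r r-over (ss , y≤) = map⁺ precompose ss , (begin
    reindex r y                                    ≤⟨ Reindex.mono r y≤ ⟩
    reindex r (⋁⁺ (map⁺ (pull E) ss))              ≈⟨ Reindex.⋁⁺-homo r (pull E) ss ⟩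
    ⋁⁺ (map⁺ (λ ov → reindex r (pull E ov)) ss)    ≈⟨ ⋁⁺-cong reindex-pull ss ⟨
    ⋁⁺ (map⁺ (λ ov → pull E (precompose ov)) ss)   ≡⟨ ≡.cong ⋁⁺ (map-∘ ss) ⟩
    ⋁⁺ (map⁺ (pull E) (map⁺ precompose ss))        ∎)
    where
    open Fibre (d ⊗ c)

    precompose : Over e E → Over d E
    precompose (k , s , s-over) = k , s ∘ r , ∘-over s-over r-over

    reindex-pull : ∀ ov → pull E (precompose ov) ≈ reindex r (pull E ov)
    reindex-pull (k , s , _) = reindex-∘ s r _

  ◁-trans : ∀ {q B E} → q ◁ B → B ≤∃ E → q ◁ E
  ◁-trans {d , x} {B} {E} (rs , x≤) B≤E = ≤-◁-trans {E = E} x≤ (◁-⋁⁺ {E = E} (pull B) rs pull-◁)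
    where
    pull-◁ : ∀ ov → (d , pull B ov) ◁ E
    pull-◁ (j , r , r-over) = ◁-reindex {E = E} r r-over (B≤E j)

  ≤∃-trans : ∀ {A B E} → A ≤∃ B → B ≤∃ E → A ≤∃ E
  ≤∃-trans {A} {B} {E} A≤B B≤E i = ◁-trans {lookup A i} {B} {E} (A≤B i) B≤E

  ≤∃-preorder : Preorder (o ⊔ a) (o ⊔ a) (h ⊔ l)
  ≤∃-preorder = record
    { _≈_        = _≡_
    ; _≲_        = _≤∃_
    ; isPreorder = record
      { isEquivalence = ≡.isEquivalence
      ; reflexive     = λ { {A} ≡.refl → ≤∃-refl {A} }
      ; trans         = λ {A} {B} {E} → ≤∃-trans {A} {B} {E}
      }
    }

  module ≈∃ = Setoid (PreorderProperties.InducedEquivalence ≤∃-preorder)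

  ≤∃-isPartialOrder : IsPartialOrder (_≈∃_ {c}) _≤∃_
  ≤∃-isPartialOrder = record
    { isPreorder = record
      { isEquivalence = ≈∃.isEquivalence
      ; reflexive     = proj₁
      ; trans         = λ {A} {B} {E} → ≤∃-trans {A} {B} {E}
      }
    ; antisym = _,_
    }

  ++-supremum : Supremum (_≤∃_ {c}) _++_
  ++-supremum A B =
    ⊆⇒≤∃ {A} (xs⊆xs++ys A B) , ⊆⇒≤∃ {B} (xs⊆ys++xs B A) , ++-least
    where
    ++-least : ∀ E → A ≤∃ E → B ≤∃ E → (A ++ B) ≤∃ E
    ++-least E A≤E B≤E = ◁⇒≤∃ {A ++ B} {E}
      (λ q∈A++B → [ ≤∃⇒◁ {A} {E} A≤E , ≤∃⇒◁ {B} {E} B≤E ]′ (∈-++⁻ A q∈A++B))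

  _⊓_ : Pair c → Pair c → Pair c
  (d , x) ⊓ (e , y) = d ⊗ e , Fibre._∧_ ((d ⊗ e) ⊗ c) (reindex p₁ x) (reindex p₂ y)

  infixr 7 _∧∃_

  -- Enumerating B in the outer loop makes ∧∃ distribute over ++ on the nose.
  _∧∃_ : Rep c → Rep c → Rep c
  A ∧∃ B = cartesianProductWith (flip _⊓_) B A

  ∧∃-distribˡ-++ : ∀ A B E → A ∧∃ (B ++ E) ≡ A ∧∃ B ++ A ∧∃ E
  ∧∃-distribˡ-++ A B E = cartesianProductWith-distribʳ-++ (flip _⊓_) B E A

  ∈-∧∃⁺ : ∀ {p q A B} → p ∈ A → q ∈ B → p ⊓ q ∈ A ∧∃ B
  ∈-∧∃⁺ p∈A q∈B = ∈-cartesianProductWith⁺ (flip _⊓_) q∈B p∈A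

  ∈-∧∃⁻ : ∀ A B {v} → v ∈ A ∧∃ B → ∃₂ λ p q → p ∈ A × q ∈ B × v ≡ p ⊓ q
  ∈-∧∃⁻ A B v∈A∧B with ∈-cartesianProductWith⁻ (flip _⊓_) B A v∈A∧B
  ... | q , p , q∈B , p∈A , v≡p⊓q = p , q , p∈A , q∈B , v≡p⊓q

  reindex-⟪⟫ : ∀ {x d e u v} {r : Hom (x ⊗ c) (d ⊗ c)} {s : Hom (x ⊗ c) (e ⊗ c)} →
               π₂ ∘ r ≡ π₂ → π₂ ∘ s ≡ π₂ →
               Fibre._≈_ (x ⊗ c) (reindex ⟪ r , s ⟫ (proj₂ ((d , u) ⊓ (e , v))))
                                 (Fibre._∧_ (x ⊗ c) (reindex r u) (reindex s v))
  reindex-⟪⟫ {x} {d} {e} {u} {v} {r} {s} r-over s-over = begin-equality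
    reindex ⟪ r , s ⟫ (proj₂ ((d , u) ⊓ (e , v)))
      ≈⟨ ∧-homo _ _ ⟩
    reindex ⟪ r , s ⟫ (reindex p₁ u) ∧ reindex ⟪ r , s ⟫ (reindex p₂ v)
      ≈⟨ ∧-cong (reindex-∘ p₁ ⟪ r , s ⟫ u) (reindex-∘ p₂ ⟪ r , s ⟫ v) ⟨
    reindex (p₁ ∘ ⟪ r , s ⟫) u ∧ reindex (p₂ ∘ ⟪ r , s ⟫) v
      ≡⟨ ≡.cong₂ (λ r′ s′ → reindex r′ u ∧ reindex s′ v) (p₁-β r-over) (p₂-β s-over) ⟩
    reindex r u ∧ reindex s v
      ∎
    where
    open Fibre (x ⊗ c)
    open LatticeMorphisms.IsLatticeHomomorphism (reindex-hom ⟪ r , s ⟫) using (∧-homo)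

  ⊓-◁ˡ : ∀ {p q A} → p ∈ A → p ⊓ q ◁ A
  ⊓-◁ˡ {d , u} {e , v} {A} p∈A =
    ≤-◁-trans {E = A} (x∧y≤x _ _) (◁-reindex {E = A} p₁ (π₂-β _ _) (∈⇒◁ p∈A))
    where open Fibre ((d ⊗ e) ⊗ c)

  ⊓-◁ʳ : ∀ {p q B} → q ∈ B → p ⊓ q ◁ B
  ⊓-◁ʳ {d , u} {e , v} {B} q∈B =
    ≤-◁-trans {E = B} (x∧y≤y _ _) (◁-reindex {E = B} p₂ (π₂-β _ _) (∈⇒◁ q∈B))
    where open Fibre ((d ⊗ e) ⊗ c)

  pull-∧-◁ : ∀ {A B e} (ov : Over e A) (ov′ : Over e B) →
             (e , Fibre._∧_ (e ⊗ c) (pull A ov) (pull B ov′)) ◁ A ∧∃ B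
  pull-∧-◁ {A} {B} {e} (i , r , r-over) (j , s , s-over) =
    ≤-◁-trans {E = A ∧∃ B} (≤-reflexive (sym (reindex-⟪⟫ r-over s-over)))
      (◁-reindex {E = A ∧∃ B} ⟪ r , s ⟫ (π₂-β _ _) (∈⇒◁ lookup-⊓-∈))
    where
    open Fibre (e ⊗ c)

    lookup-⊓-∈ : lookup A i ⊓ lookup B j ∈ A ∧∃ B
    lookup-⊓-∈ = ∈-∧∃⁺ (∈-lookup {xs = A} i) (∈-lookup {xs = B} j)

  ◁-∧∃ : ∀ {q A B} → q ◁ A → q ◁ B → q ◁ A ∧∃ B
  ◁-∧∃ {e , z} {A} {B} (rs , z≤X) (ss , z≤Y) =
    ≤-◁-trans {E = A ∧∃ B}
      (≤-trans (∧-greatest z≤X z≤Y) (≤-reflexive (∧-distribʳ-⋁⁺ Y (pull A) rs)))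
      (◁-⋁⁺ {E = A ∧∃ B} (λ ov → pull A ov ∧ Y) rs row)
    where
    open Fibre (e ⊗ c)

    Y : ∣ e ⊗ c ∣
    Y = ⋁⁺ (map⁺ (pull B) ss)

    row : ∀ ov → (e , pull A ov ∧ Y) ◁ A ∧∃ B
    row ov = ≤-◁-trans {E = A ∧∃ B} (≤-reflexive (∧-distribˡ-⋁⁺ (pull A ov) (pull B) ss))
      (◁-⋁⁺ {E = A ∧∃ B} (λ ov′ → pull A ov ∧ pull B ov′) ss (pull-∧-◁ {A} {B} ov))

  ∧∃-infimum : Infimum (_≤∃_ {c}) _∧∃_
  ∧∃-infimum A B = ◁⇒≤∃ {A ∧∃ B} {A} lowerˡ , ◁⇒≤∃ {A ∧∃ B} {B} lowerʳ ,
    λ E E≤A E≤B i → ◁-∧∃ {lookup E i} {A} {B} (E≤A i) (E≤B i)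
    where
    lowerˡ : ∀ {w} → w ∈ A ∧∃ B → w ◁ A
    lowerˡ w∈A∧B with ∈-∧∃⁻ A B w∈A∧B
    ... | _ , _ , p∈A , _ , ≡.refl = ⊓-◁ˡ p∈A

    lowerʳ : ∀ {w} → w ∈ A ∧∃ B → w ◁ B
    lowerʳ w∈A∧B with ∈-∧∃⁻ A B w∈A∧B
    ... | _ , _ , _ , q∈B , ≡.refl = ⊓-◁ʳ q∈B

lemma4p1 : ∀ {o h a l} (C : CartesianCategory o h) (D : Doctrine C a l)
           (c : CartesianCategory.Obj C) →
           Existential.IsDistributiveLattice∃ D c
lemma4p1 C D c = _++_ , _∧∃_ , record
  { isLattice = record
    { isPartialOrder = ≤∃-isPartialOrder
    ; supremum       = ++-supremum
    ; infimum        = ∧∃-infimum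
    }
  ; ∧-distribˡ-∨ = λ A B E → ≈∃.reflexive (∧∃-distribˡ-++ A B E)
  }
  where open Completion D c
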